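{- For integers $0\le m<n$, \[\binom{2n}{n}=\frac{n+m+1}{m+1}\left(\prod_{k=0}^{m}\frac{n+k}{n-k}\right)\sum_{k=0}^{n-m-1}\mathcal{C}_{k+m,m}\,\mathcal{C}_{n-m-k-1,0}.\]
   Context: A path is a finite sequence of points of $\mathbb{Z}^2$ in which each step is $(1,0)$ or $(0,1)$. For integers $0\le m\le n$, $\mathcal{C}_{n,m}$ denotes the number of paths from $(0,-2m)$ to $(n-m,n-m)$ not crossing the line $y=x$, i.e. all of whose points $(p,q)$ satisfy $q\le p$. -}

module Defs where

open import Data.Bool using (Bool; true; false)
open import Data.Nat using (ℕ; zero; suc; _+_; _∸_)
open import Data.Integer as ℤ using (ℤ; +_; -_; _≤?_)
open import Data.List using (List; []; _∷_; map; _++_; length; filterᵇ; foldr; upTo)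
open import Data.Product using (_×_; _,_)
open import Relation.Nullary.Decidable using (⌊_⌋)
open import Data.Rational as ℚ using (ℚ; _/_)

-- A path step: false = (1,0), true = (0,1).
Step : Set
Step = Bool

allSeqs : ℕ → List (List Step)
allSeqs zero = [] ∷ []
allSeqs (suc L) = map (false ∷_) (allSeqs L) ++ map (true ∷_) (allSeqs L)

Point : Set
Point = ℤ × ℤ

move : Point → Step → Point
move (p , q) false = (p ℤ.+ + 1 , q)
move (p , q) true  = (p , q ℤ.+ + 1)

points : Point → List Step → List Point
points s [] = s ∷ []
points s (d ∷ ds) = s ∷ points (move s d) ds

endpoint : Point → List Step → Point
endpoint s [] = s
endpoint s (d ∷ ds) = endpoint (move s d) ds

belowDiag : Point → Bool
belowDiag (p , q) = ⌊ q ≤? p ⌋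

allB : List Bool → Bool
allB = foldr Data.Bool._∧_ true

eqPt : Point → Point → Bool
eqPt (a , b) (c , d) = ⌊ a ℤ.≟ c ⌋ Data.Bool.∧ ⌊ b ℤ.≟ d ⌋

goodPath : Point → Point → List Step → Bool
goodPath s t ds = eqPt (endpoint s ds) t Data.Bool.∧ allB (map belowDiag (points s ds))

-- 𝒞 n m : number of paths from (0,-2m) to (n-m,n-m) all of whose points (p,q)
-- satisfy q ≤ p.  Every such path has exactly (n-m) + (n+m) = 2n steps
-- (for m ≤ n), so we count among all step sequences of length 2n
-- (any path between these endpoints has this length).
𝒞 : ℕ → ℕ → ℕ
𝒞 n m = length (filterᵇ (goodPath (+ 0 , - (+ (2 Data.Nat.* m))) (+ (n ∸ m) , + (n ∸ m)))
                        (allSeqs (2 Data.Nat.* n)))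

-- the rational a / b (b is always nonzero where used; value 0 if b = 0)
frac : ℕ → ℕ → ℚ
frac a zero = ℚ.0ℚ
frac a (suc b) = (+ a) / suc b

ℕtoℚ : ℕ → ℚ
ℕtoℚ a = (+ a) / 1

prodℚ : ℕ → (ℕ → ℚ) → ℚ
prodℚ N f = foldr ℚ._*_ ℚ.1ℚ (map f (upTo N))

sumℕ : ℕ → (ℕ → ℕ) → ℕ
sumℕ N f = foldr _+_ 0 (map f (upTo N))

{-# OPTIONS --safe #-}
-- Measuring the distance p − q of a lattice point from the diagonal turns 𝒞 (k + m) m into the
-- number of ±1 walks of length 2(k + m) from height 2m to height 0 that never go below 0.
-- Splitting a nonnegative walk of length 2n − 1 from height 2m to height 1 at its last visit
-- to 0 shows that the sum in the statement counts those of these walks that touch 0, so by the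
-- reflection principle it equals C(2n − 1, n + m) − C(2n − 1, n + m + 1). The ratio of these
-- two binomial coefficients is (n − m − 1)/(n + m + 1), and C(2n − 1, n + m) is
-- ½ C(2n, n) ∏_{k ≤ m} (n − k)/(n + k), which gives the formula.
module Submission where

open import Defs

module SumsAndProducts where

  open import Data.Nat
  open import Data.Nat.Properties
  open import Data.Nat.ListAction using (sum; product)
  open import Data.Nat.ListAction.Properties using (product-++)
  open import Data.List using (_++_; [_]; map; upTo)
  open import Data.List.Properties using (map-applyUpTo; map-upTo; map-++; upTo-∷ʳ)
  open import Algebra.Properties.CommutativeSemigroup +-commutativeSemigroup
    using () renaming (interchange to +-interchange)
  open import Function using (_∘_)
  open import Relation.Binary.PropositionalEquality hiding ([_])

  conv : (ℕ → ℕ) → (ℕ → ℕ) → ℕ → ℕ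
  conv f g zero    = 0
  conv f g (suc N) = f 0 * g N + conv (f ∘ suc) g N

  sumℕ-suc : ∀ N f → sumℕ (suc N) f ≡ f 0 + sumℕ N (f ∘ suc)
  sumℕ-suc N f = cong (λ xs → f 0 + sum xs)
    (trans (map-applyUpTo suc f N) (sym (map-upTo (f ∘ suc) N)))

  sumℕ≡conv : ∀ N f g → sumℕ N (λ i → f i * g (N ∸ i ∸ 1)) ≡ conv f g N
  sumℕ≡conv zero    f g = refl
  sumℕ≡conv (suc N) f g = trans (sumℕ-suc N _) (cong (f 0 * g N +_) (sumℕ≡conv N (f ∘ suc) g))

  conv-cong : ∀ N {f f′ g g′} → (∀ i → f i ≡ f′ i) → (∀ j → g j ≡ g′ j) →
              conv f g N ≡ conv f′ g′ N
  conv-cong zero    f≗f′ g≗g′ = refl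
  conv-cong (suc N) f≗f′ g≗g′ =
    cong₂ _+_ (cong₂ _*_ (f≗f′ 0) (g≗g′ N)) (conv-cong N (f≗f′ ∘ suc) g≗g′)

  conv-distribʳ-+ : ∀ N f f′ g → conv (λ i → f i + f′ i) g N ≡ conv f g N + conv f′ g N
  conv-distribʳ-+ zero    f f′ g = refl
  conv-distribʳ-+ (suc N) f f′ g = begin
    (f 0 + f′ 0) * g N + conv (λ i → f (suc i) + f′ (suc i)) g N
      ≡⟨ cong₂ _+_ (*-distribʳ-+ (g N) (f 0) (f′ 0))
                   (conv-distribʳ-+ N (f ∘ suc) (f′ ∘ suc) g) ⟩
    (f 0 * g N + f′ 0 * g N) + (conv (f ∘ suc) g N + conv (f′ ∘ suc) g N)
      ≡⟨ +-interchange (f 0 * g N) _ _ _ ⟩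
    (f 0 * g N + conv (f ∘ suc) g N) + (f′ 0 * g N + conv (f′ ∘ suc) g N) ∎
    where open ≡-Reasoning

  conv-shift : ∀ p N f g → (∀ i → i < p → f i ≡ 0) →
               conv f g (p + N) ≡ conv (λ i → f (p + i)) g N
  conv-shift zero    N f g f≡0 = refl
  conv-shift (suc p) N f g f≡0 = cong₂ _+_ (cong (_* g (p + N)) (f≡0 0 z<s))
    (conv-shift p N (f ∘ suc) g (λ i i<p → f≡0 (suc i) (s<s i<p)))

  conv-even : ∀ K f g → (∀ k → f (suc (k * 2)) ≡ 0) →
              conv f g (suc (K * 2)) ≡ conv (λ k → f (k * 2)) (λ k → g (k * 2)) (suc K)
  conv-even zero    f g f-odd≡0 = refl
  conv-even (suc K) f g f-odd≡0 = cong (f 0 * g (suc K * 2) +_) (begin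
    f 1 * g (suc (K * 2)) + conv (f ∘ suc ∘ suc) g (suc (K * 2))
      ≡⟨ cong (λ x → x * g (suc (K * 2)) + conv (f ∘ suc ∘ suc) g (suc (K * 2))) (f-odd≡0 0) ⟩
    conv (f ∘ suc ∘ suc) g (suc (K * 2))
      ≡⟨ conv-even K (f ∘ suc ∘ suc) g (f-odd≡0 ∘ suc) ⟩
    conv (λ k → f (suc k * 2)) (λ k → g (k * 2)) (suc K) ∎)
    where open ≡-Reasoning

  prodℕ : ℕ → (ℕ → ℕ) → ℕ
  prodℕ M f = product (map f (upTo M))

  prodℕ-suc : ∀ M f → prodℕ (suc M) f ≡ prodℕ M f * f M
  prodℕ-suc M f = begin
    product (map f (upTo (suc M)))
      ≡⟨ cong (product ∘ map f) (sym (upTo-∷ʳ M)) ⟩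
    product (map f (upTo M ++ [ M ]))
      ≡⟨ cong product (map-++ f (upTo M) [ M ]) ⟩
    product (map f (upTo M) ++ [ f M ])
      ≡⟨ product-++ (map f (upTo M)) [ f M ] ⟩
    prodℕ M f * (f M * 1)
      ≡⟨ cong (prodℕ M f *_) (*-identityʳ (f M)) ⟩
    prodℕ M f * f M ∎
    where open ≡-Reasoning

  prodℕ-nonZero : ∀ M f → (∀ k → k < M → NonZero (f k)) → NonZero (prodℕ M f)
  prodℕ-nonZero zero    f f≢0 = _
  prodℕ-nonZero (suc M) f f≢0 = subst NonZero (sym (prodℕ-suc M f))
    (m*n≢0 (prodℕ M f) (f M) {{prodℕ-nonZero M f (λ k k<M → f≢0 k (m<n⇒m<1+n k<M))}}
                            {{f≢0 M ≤-refl}})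

module Walks where

  open import Data.Nat
  open import Data.Nat.Properties
  open import Data.Nat.Combinatorics using (_C_; nCk+nC[k+1]≡[n+1]C[k+1]; k>n⇒nCk≡0)
  open import Data.Nat.Tactic.RingSolver using (solve-∀)
  open import Algebra.Properties.CommutativeSemigroup +-commutativeSemigroup
    using () renaming (interchange to +-interchange)
  open import Function using (_∘_)
  open import Relation.Nullary using (contradiction)
  open import Relation.Binary.PropositionalEquality
  open SumsAndProducts

  δ : ℕ → ℕ → ℕ
  δ zero    zero    = 1
  δ zero    (suc _) = 0
  δ (suc _) zero    = 0
  δ (suc h) (suc e) = δ h e

  δ-refl : ∀ h → δ h h ≡ 1
  δ-refl zero    = refl
  δ-refl (suc h) = δ-refl h

  δ-≢ : ∀ h e → h ≢ e → δ h e ≡ 0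
  δ-≢ zero    zero    h≢e = contradiction refl h≢e
  δ-≢ zero    (suc e) h≢e = refl
  δ-≢ (suc h) zero    h≢e = refl
  δ-≢ (suc h) (suc e) h≢e = δ-≢ h e (h≢e ∘ cong suc)

  -- walks L h e counts the ±1 walks of length L from height h to height e that never go
  -- below 0; walksDown L h e counts those of length L + 1 whose first step is down.
  mutual
    walks : ℕ → ℕ → ℕ → ℕ
    walks zero    h e = δ h e
    walks (suc L) h e = walks L (suc h) e + walksDown L h e

    walksDown : ℕ → ℕ → ℕ → ℕ
    walksDown L zero    e = 0
    walksDown L (suc h) e = walks L h e

  e+L<h⇒walks≡0 : ∀ L {h e} → e + L < h → walks L h e ≡ 0
  e+L<h⇒walks≡0 zero    {h} {e} e+0<h = δ-≢ h e λ { refl → m+n≮m e 0 e+0<h }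
  e+L<h⇒walks≡0 (suc L) {h} {e} e+1+L<h =
    cong₂ _+_ (e+L<h⇒walks≡0 L (m<n⇒m<1+n (<-trans (+-monoʳ-< e (n<1+n L)) e+1+L<h)))
              (down h e+1+L<h)
    where
    down : ∀ h → e + suc L < h → walksDown L h e ≡ 0
    down zero    _        = refl
    down (suc h) e+1+L<h = e+L<h⇒walks≡0 L (s<s⁻¹ (subst (_< suc h) (+-suc e L) e+1+L<h))

  h+L<e⇒walks≡0 : ∀ L {h e} → h + L < e → walks L h e ≡ 0
  h+L<e⇒walks≡0 zero    {h} {e} h+0<e = δ-≢ h e λ { refl → m+n≮m h 0 h+0<e }
  h+L<e⇒walks≡0 (suc L) {h} {e} h+1+L<e =
    cong₂ _+_ (h+L<e⇒walks≡0 L (subst (_< e) (+-suc h L) h+1+L<e)) (down h h+1+L<e)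
    where
    down : ∀ h → h + suc L < e → walksDown L h e ≡ 0
    down zero    _        = refl
    down (suc h) h+2+L<e = h+L<e⇒walks≡0 L
      (<-trans (n<1+n _) (<-trans (n<1+n _) (subst (_< e) (+-suc (suc h) L) h+2+L<e)))

  walksDown[L,h,1+L+h]≡0 : ∀ L h → walksDown L h (suc (L + h)) ≡ 0
  walksDown[L,h,1+L+h]≡0 L zero    = refl
  walksDown[L,h,1+L+h]≡0 L (suc h) =
    h+L<e⇒walks≡0 L (s≤s (subst (_≤ L + suc h) (+-comm L h) (+-monoʳ-≤ L (n≤1+n h))))

  walks-straight-down : ∀ L e → walks L (e + L) e ≡ 1
  walks-straight-down zero e rewrite +-identityʳ e = δ-refl e
  walks-straight-down (suc L) e rewrite +-suc e L =
    cong₂ _+_ (e+L<h⇒walks≡0 L (m<n⇒m<1+n (n<1+n (e + L)))) (walks-straight-down L e)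

  walks-odd≡0 : ∀ L {h e} k → h + e + L ≡ suc (k * 2) → walks L h e ≡ 0
  walks-odd≡0 zero {h} {e} k odd =
    δ-≢ h e λ { refl → even≢odd h k (trans (double h) (trans odd (cong suc (*-comm k 2)))) }
    where
    double : ∀ h → 2 * h ≡ h + h + 0
    double = solve-∀
  walks-odd≡0 (suc L) {h} {e} k odd =
    cong₂ _+_ (walks-odd≡0 L k (trans (step-up h e L) odd)) (down h k odd)
    where
    step-up : ∀ h e L → suc h + e + L ≡ h + e + suc L
    step-up = solve-∀
    step-down : ∀ h e L → suc h + e + suc L ≡ suc (suc (h + e + L))
    step-down = solve-∀
    down : ∀ h k → h + e + suc L ≡ suc (k * 2) → walksDown L h e ≡ 0
    down zero    k       _   = refl
    down (suc h) zero    odd = contradiction (suc-injective odd) (m+1+n≢0 (h + e))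
    down (suc h) (suc k) odd =
      walks-odd≡0 L k (suc-injective (suc-injective (trans (sym (step-down h e L)) odd)))

  -- Shifted up by one, the walks counted by walksDown L h e are those from h to e + 1 that
  -- avoid 0; the others are split at their last visit to 0.
  walks-decomposition : ∀ L h e →
    walks L h (suc e) ≡ walksDown L h e + conv (λ i → walks i h 0) (λ j → walks j 0 e) L
  walks-decomposition zero    zero    e = refl
  walks-decomposition zero    (suc h) e = sym (+-identityʳ _)
  walks-decomposition (suc L) zero    e = begin
    walks L 1 (suc e) + 0
      ≡⟨ +-identityʳ _ ⟩
    walks L 1 (suc e)
      ≡⟨ walks-decomposition L 1 e ⟩
    walks L 0 e + conv (λ i → walks i 1 0) g L
      ≡⟨ cong₂ _+_ (sym (*-identityˡ _))
                   (conv-cong L (λ i → sym (+-identityʳ _)) (λ _ → refl)) ⟩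
    1 * walks L 0 e + conv (λ i → walks (suc i) 0 0) g L ∎
    where
    open ≡-Reasoning
    g : ℕ → ℕ
    g j = walks j 0 e
  walks-decomposition (suc L) (suc h) e = begin
    walks L (2 + h) (suc e) + walks L h (suc e)
      ≡⟨ cong₂ _+_ (walks-decomposition L (2 + h) e) (walks-decomposition L h e) ⟩
    (walks L (suc h) e + conv f₂ g L) + (walksDown L h e + conv f₀ g L)
      ≡⟨ +-interchange (walks L (suc h) e) _ _ _ ⟩
    (walks L (suc h) e + walksDown L h e) + (conv f₂ g L + conv f₀ g L)
      ≡⟨ cong (walks (suc L) h e +_) (sym (conv-distribʳ-+ L f₂ f₀ g)) ⟩
    walks (suc L) h e + conv (λ i → walks (suc i) (suc h) 0) g L ∎
    where
    open ≡-Reasoning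
    g f₂ f₀ : ℕ → ℕ
    g  j = walks j 0 e
    f₂ i = walks i (2 + h) 0
    f₀ i = walks i h 0

  -- The ballot theorem (reflection principle): a and b are the numbers of up and down steps.
  mutual
    ballot : ∀ L a b h e → a + b ≡ L → e + b ≡ a + h → walks L h e + L C suc (a + h) ≡ L C a
    ballot L       zero    .L .(e + L) e refl refl =
      cong₂ _+_ (walks-straight-down L e) (k>n⇒nCk≡0 (s≤s (m≤n+m L e)))
    ballot (suc L) (suc a) b h e a+b≡L e+b≡a+h = begin
      walks (suc L) h e + suc L C suc (suc (a + h))
        ≡⟨ cong (walks (suc L) h e +_) (sym (nCk+nC[k+1]≡[n+1]C[k+1] L (suc (a + h)))) ⟩
      (walks L (suc h) e + walksDown L h e) + (L C suc (a + h) + L C suc (suc (a + h)))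
        ≡⟨ +-exchange (walks L (suc h) e) _ _ _ ⟩
      (walks L (suc h) e + L C suc (suc (a + h))) + (walksDown L h e + L C suc (a + h))
        ≡⟨ cong₂ _+_ up (down b a+b≡L e+b≡a+h) ⟩
      L C a + L C suc a
        ≡⟨ nCk+nC[k+1]≡[n+1]C[k+1] L a ⟩
      suc L C suc a ∎
      where
      open ≡-Reasoning
      +-exchange : ∀ x y u v → (x + y) + (u + v) ≡ (x + v) + (y + u)
      +-exchange = solve-∀
      up : walks L (suc h) e + L C suc (suc (a + h)) ≡ L C a
      up = subst (λ k → walks L (suc h) e + L C suc k ≡ L C a) (+-suc a h)
             (ballot L a b (suc h) e (suc-injective a+b≡L) (trans e+b≡a+h (sym (+-suc a h))))
      down : ∀ b → suc a + b ≡ suc L → e + b ≡ suc a + h →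
             walksDown L h e + L C suc (a + h) ≡ L C suc a
      down (suc b) 1+a+b≡1+L e+b≡1+a+h =
        walksDown-ballot L (suc a) b h e (trans (sym (+-suc a b)) (suc-injective 1+a+b≡1+L))
                                         (trans (sym (+-suc e b)) e+b≡1+a+h)
      down zero 1+a≡1+L e≡1+a+h
        with refl ← trans (sym (+-identityʳ a)) (suc-injective 1+a≡1+L)
           | refl ← trans (sym (+-identityʳ e)) e≡1+a+h =
        cong₂ _+_ (walksDown[L,h,1+L+h]≡0 a h)
                  (trans (k>n⇒nCk≡0 (s≤s (m≤m+n a h))) (sym (k>n⇒nCk≡0 (n<1+n a))))

    walksDown-ballot : ∀ L a b h e → a + b ≡ L → suc (e + b) ≡ a + h →
                       walksDown L h e + L C (a + h) ≡ L C a
    walksDown-ballot L a b zero    e _     _ = cong (L C_) (+-identityʳ a)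
    walksDown-ballot L a b (suc h) e a+b≡L 1+e+b≡a+h =
      subst (λ k → walks L h e + L C k ≡ L C a) (sym (+-suc a h))
        (ballot L a b h e a+b≡L (suc-injective (trans 1+e+b≡a+h (+-suc a h))))

  conv-walks-ballot : ∀ L a b h e → a + b ≡ L → suc (e + b) ≡ a + h →
    conv (λ i → walks i h 0) (λ j → walks j 0 e) L + L C suc (a + h) ≡ L C (a + h)
  conv-walks-ballot L a b h e a+b≡L 1+e+b≡a+h = +-cancelˡ-≡ (walksDown L h e) _ _ (begin
    walksDown L h e + (conv f g L + L C suc (a + h))
      ≡⟨ sym (+-assoc (walksDown L h e) _ _) ⟩
    (walksDown L h e + conv f g L) + L C suc (a + h)
      ≡⟨ cong (_+ L C suc (a + h)) (sym (walks-decomposition L h e)) ⟩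
    walks L h (suc e) + L C suc (a + h)
      ≡⟨ ballot L a b h (suc e) a+b≡L 1+e+b≡a+h ⟩
    L C a
      ≡⟨ sym (walksDown-ballot L a b h e a+b≡L 1+e+b≡a+h) ⟩
    walksDown L h e + L C (a + h) ∎)
    where
    open ≡-Reasoning
    f g : ℕ → ℕ
    f i = walks i h 0
    g j = walks j 0 e

  conv-walks-even : ∀ m K g →
    conv (λ i → walks i (m * 2) 0) g (m * 2 + suc (K * 2))
      ≡ conv (λ k → walks (m * 2 + k * 2) (m * 2) 0) (λ k → g (k * 2)) (suc K)
  conv-walks-even m K g = trans
    (conv-shift (m * 2) (suc (K * 2)) _ g (λ i i<2m → e+L<h⇒walks≡0 i i<2m))
    (conv-even K (λ i → walks (m * 2 + i) (m * 2) 0) g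
      (λ k → walks-odd≡0 (m * 2 + suc (k * 2)) (m + m + k) (odd m k)))
    where
    odd : ∀ m k → m * 2 + 0 + (m * 2 + suc (k * 2)) ≡ suc ((m + m + k) * 2)
    odd = solve-∀

module LatticePaths where

  open import Data.Bool using (Bool; true; false; _∧_; T; T?)
  open import Data.Bool.Properties using (∧-zeroʳ)
  open import Data.Nat using (ℕ; zero; suc; _+_; _*_; _∸_; _≤_; z<s)
  open import Data.Nat.Properties
    using (+-suc; +-identityʳ; *-comm; suc-injective; m+n∸n≡m; m+n∸m≡n; m≤n⇒∃[o]m+o≡n)
  open import Data.Nat.Combinatorics using (_C_)
  import Data.Nat.Tactic.RingSolver as ℕ-Solver
  open import Data.Integer as ℤ using (ℤ; +_; -_; _-_; +<+; -<+; _≟_; _≤?_)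
  import Data.Integer.Properties as ℤ
  import Data.Integer.Tactic.RingSolver as ℤ-Solver
  open import Data.List using (List; []; _∷_; _++_; map; length; filterᵇ)
  open import Data.List.Properties using (filter-++; filter-none; length-++)
  open import Data.List.Relation.Unary.All using (universal)
  open import Data.Product using (_,_)
  open import Function using (_∘_)
  open import Relation.Nullary using (Dec; ¬_)
  open import Relation.Nullary.Decidable using (⌊_⌋; isYes≗does; dec-true; dec-false)
  open import Relation.Binary.PropositionalEquality
  open SumsAndProducts
  open Walks

  module _ {A : Set} where

    length-filterᵇ-++ : ∀ p (xs ys : List A) →
      length (filterᵇ p (xs ++ ys)) ≡ length (filterᵇ p xs) + length (filterᵇ p ys)
    length-filterᵇ-++ p xs ys =
      trans (cong length (filter-++ (T? ∘ p) xs ys)) (length-++ (filterᵇ p xs))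

    length-filterᵇ-map : ∀ {p q : A → Bool} f → (∀ x → p (f x) ≡ q x) →
      ∀ xs → length (filterᵇ p (map f xs)) ≡ length (filterᵇ q xs)
    length-filterᵇ-map f pf≗q []       = refl
    length-filterᵇ-map {q = q} f pf≗q (x ∷ xs) rewrite pf≗q x with q x
    ... | true  = cong suc (length-filterᵇ-map f pf≗q xs)
    ... | false = length-filterᵇ-map f pf≗q xs

  ⌊⌋-true : ∀ {A : Set} (a? : Dec A) → A → ⌊ a? ⌋ ≡ true
  ⌊⌋-true a? a = trans (isYes≗does a?) (dec-true a? a)

  ⌊⌋-false : ∀ {A : Set} (a? : Dec A) → ¬ A → ⌊ a? ⌋ ≡ false
  ⌊⌋-false a? ¬a = trans (isYes≗does a?) (dec-false a? ¬a)

  pathCount : Point → Point → ℕ → ℕ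
  pathCount s t L = length (filterᵇ (goodPath s t) (allSeqs L))

  goodPath-∷ : ∀ {s t} d ds → belowDiag s ≡ true →
               goodPath s t (d ∷ ds) ≡ goodPath (move s d) t ds
  goodPath-∷ d ds below rewrite below = refl

  goodPath-above : ∀ {s t} ds → belowDiag s ≡ false → goodPath s t ds ≡ false
  goodPath-above []       above rewrite above = ∧-zeroʳ _
  goodPath-above (d ∷ ds) above rewrite above = ∧-zeroʳ _

  pathCount-suc : ∀ {s t} L → belowDiag s ≡ true →
    pathCount s t (suc L) ≡ pathCount (move s false) t L + pathCount (move s true) t L
  pathCount-suc {s} {t} L below =
    trans (length-filterᵇ-++ (goodPath s t) (map (false ∷_) (allSeqs L)) (map (true ∷_) (allSeqs L)))
    (cong₂ _+_ (length-filterᵇ-map (false ∷_) (λ ds → goodPath-∷ false ds below) (allSeqs L))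
               (length-filterᵇ-map (true ∷_)  (λ ds → goodPath-∷ true  ds below) (allSeqs L)))

  pathCount-above : ∀ {s t} L → belowDiag s ≡ false → pathCount s t L ≡ 0
  pathCount-above {s} {t} L above = cong length
    (filter-none (T? ∘ goodPath s t) (universal (λ ds → subst T (goodPath-above ds above)) (allSeqs L)))

  module _ (T : ℤ) where

    -- pt r h lies h steps to the right of the diagonal and r steps below the target (T , T),
    -- so a path from it to the target has r up-steps and r − h right-steps.
    pt : ℕ → ℕ → Point
    pt r h = (T - + r ℤ.+ + h , T - + r)

    belowDiag-pt : ∀ r h → belowDiag (pt r h) ≡ true
    belowDiag-pt r h = ⌊⌋-true (_ ≤? _) (ℤ.i≤i+j (T - + r) (+ h))

    eqPt-pt-target : eqPt (pt 0 0) (T , T) ≡ true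
    eqPt-pt-target = cong₂ _∧_ (⌊⌋-true (_ ≟ T) (trans (ℤ.+-identityʳ _) (ℤ.+-identityʳ T)))
                               (⌊⌋-true (_ ≟ T) (ℤ.+-identityʳ T))

    eqPt-pt-suc : ∀ r h → eqPt (pt r (suc h)) (T , T) ≡ false
    eqPt-pt-suc zero    h = cong (_∧ _) (⌊⌋-false (_ ≟ T) λ eq →
      ℤ.<⇒≢ (ℤ.+-monoʳ-< T (+<+ z<s)) (trans (ℤ.+-identityʳ T) (trans (sym eq)
        (cong (ℤ._+ + suc h) (ℤ.+-identityʳ T)))))
    eqPt-pt-suc (suc r) h = trans
      (cong (⌊ T - + suc r ℤ.+ + suc h ≟ T ⌋ ∧_) (⌊⌋-false (_ ≟ T) λ eq →
        ℤ.<⇒≢ (ℤ.+-monoʳ-< T -<+) (trans eq (sym (ℤ.+-identityʳ T)))))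
      (∧-zeroʳ _)

    belowDiag-up : ∀ r → belowDiag (move (pt r 0) true) ≡ false
    belowDiag-up r = ⌊⌋-false (_ ≤? _) (ℤ.<⇒≱ (ℤ.+-monoʳ-< (T - + r) (+<+ z<s)))

    move-right : ∀ r h → move (pt r h) false ≡ pt r (suc h)
    move-right r h = cong (_, T - + r) (shift (T - + r) (+ h))
      where
      shift : ∀ x y → x ℤ.+ y ℤ.+ + 1 ≡ x ℤ.+ (+ 1 ℤ.+ y)
      shift = ℤ-Solver.solve-∀

    move-up : ∀ r h → move (pt (suc r) (suc h)) true ≡ pt r h
    move-up r h = cong₂ _,_ (shift₁ T (+ r) (+ h)) (shift₂ T (+ r))
      where
      shift₁ : ∀ T r h → T - (+ 1 ℤ.+ r) ℤ.+ (+ 1 ℤ.+ h) ≡ T - r ℤ.+ h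
      shift₁ = ℤ-Solver.solve-∀
      shift₂ : ∀ T r → T - (+ 1 ℤ.+ r) ℤ.+ + 1 ≡ T - r
      shift₂ = ℤ-Solver.solve-∀

    pathCount≡walks : ∀ L r h → r + r ≡ h + L → pathCount (pt r h) (T , T) L ≡ walks L h 0
    pathCount≡walks zero zero zero _ rewrite eqPt-pt-target | belowDiag-pt 0 0 = refl
    pathCount≡walks zero (suc r) zero ()
    pathCount≡walks zero r (suc h) _ rewrite eqPt-pt-suc r h = refl
    pathCount≡walks (suc L) r h r+r≡h+L = begin
      pathCount (pt r h) (T , T) (suc L)
        ≡⟨ pathCount-suc L (belowDiag-pt r h) ⟩
      pathCount (move (pt r h) false) (T , T) L + pathCount (move (pt r h) true) (T , T) L
        ≡⟨ cong₂ _+_ right (up h r r+r≡h+L) ⟩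
      walks L (suc h) 0 + walksDown L h 0 ∎
      where
      open ≡-Reasoning
      right : pathCount (move (pt r h) false) (T , T) L ≡ walks L (suc h) 0
      right = trans (cong (λ s → pathCount s (T , T) L) (move-right r h))
                    (pathCount≡walks L r (suc h) (trans r+r≡h+L (+-suc h L)))
      up : ∀ h r → r + r ≡ h + suc L → pathCount (move (pt r h) true) (T , T) L ≡ walksDown L h 0
      up zero    r       _   = pathCount-above L (belowDiag-up r)
      up (suc h) zero    ()
      up (suc h) (suc r) r+r≡h+L = trans (cong (λ s → pathCount s (T , T) L) (move-up r h))
        (pathCount≡walks L r h
          (suc-injective (trans (sym (+-suc r r)) (trans (suc-injective r+r≡h+L) (+-suc h L)))))

  𝒞≡walks : ∀ j m → 𝒞 (j + m) m ≡ walks (m * 2 + j * 2) (m * 2) 0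
  𝒞≡walks j m = begin
    𝒞 (j + m) m
      ≡⟨ cong (λ x → pathCount (+ 0 , - + (2 * m)) (+ x , + x) L) (m+n∸n≡m j m) ⟩
    pathCount (+ 0 , - + (2 * m)) (+ j , + j) L
      ≡⟨ cong (λ s → pathCount s (+ j , + j) L) start ⟩
    pathCount (pt (+ j) (j + 2 * m) (2 * m)) (+ j , + j) L
      ≡⟨ pathCount≡walks (+ j) L (j + 2 * m) (2 * m) (length-balance j m) ⟩
    walks L (2 * m) 0
      ≡⟨ cong₂ (λ L h → walks L h 0) (double-+ j m) (*-comm 2 m) ⟩
    walks (m * 2 + j * 2) (m * 2) 0 ∎
    where
    open ≡-Reasoning
    L : ℕ
    L = 2 * (j + m)
    length-balance : ∀ j m → (j + 2 * m) + (j + 2 * m) ≡ 2 * m + 2 * (j + m)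
    length-balance = ℕ-Solver.solve-∀
    double-+ : ∀ j m → 2 * (j + m) ≡ m * 2 + j * 2
    double-+ = ℕ-Solver.solve-∀
    rise : ∀ j k → j - (j ℤ.+ k) ≡ - k
    rise = ℤ-Solver.solve-∀
    run : ∀ j k → + 0 ≡ j - (j ℤ.+ k) ℤ.+ k
    run = ℤ-Solver.solve-∀
    start : (+ 0 , - + (2 * m)) ≡ pt (+ j) (j + 2 * m) (2 * m)
    start rewrite ℤ.pos-+ j (2 * m) = cong₂ _,_ (run (+ j) (+ (2 * m))) (sym (rise (+ j) (+ (2 * m))))

  conv-𝒞≡conv-walks : ∀ m K →
    conv (λ k → 𝒞 (k + m) m) (λ j → 𝒞 j 0) (suc K)
      ≡ conv (λ i → walks i (m * 2) 0) (λ j → walks j 0 0) (m * 2 + suc (K * 2))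
  conv-𝒞≡conv-walks m K = trans
    (conv-cong (suc K) (λ k → 𝒞≡walks k m)
                       (λ j → trans (cong (λ x → 𝒞 x 0) (sym (+-identityʳ j))) (𝒞≡walks j 0)))
    (sym (conv-walks-even m K (λ j → walks j 0 0)))

  𝒞-convolution-ballot : ∀ {p m} → m ≤ p →
    sumℕ (suc p ∸ m) (λ k → 𝒞 (k + m) m * 𝒞 (suc p ∸ m ∸ k ∸ 1) 0)
      + (p + suc p) C suc (suc p + m)
      ≡ (p + suc p) C (suc p + m)
  𝒞-convolution-ballot {m = m} m≤p with K , refl ← m≤n⇒∃[o]m+o≡n m≤p = begin
    sumℕ N (λ k → f k * g (N ∸ k ∸ 1)) + L C suc r
      ≡⟨ cong (_+ L C suc r) (sumℕ≡conv N f g) ⟩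
    conv f g N + L C suc r
      ≡⟨ cong (λ N → conv f g N + L C suc r)
              (trans (cong (_∸ m) (sym (+-suc m K))) (m+n∸m≡n m (suc K))) ⟩
    conv f g (suc K) + L C suc r
      ≡⟨ cong (_+ L C suc r) (conv-𝒞≡conv-walks m K) ⟩
    conv-walks + L C suc r
      ≡⟨ subst₂ (λ L r → conv-walks + L C suc r ≡ L C r) (length≡ m K) (index≡ m K)
           (conv-walks-ballot (m * 2 + suc (K * 2)) (suc K) (m * 2 + K) (m * 2) 0
              (steps≡length m K) (height-balance m K)) ⟩
    L C r ∎
    where
    open ≡-Reasoning
    N L r conv-walks : ℕ
    N = suc (m + K) ∸ m
    L = m + K + suc (m + K)
    r = suc (m + K) + m
    conv-walks = conv (λ i → walks i (m * 2) 0) (λ j → walks j 0 0) (m * 2 + suc (K * 2))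
    f g : ℕ → ℕ
    f k = 𝒞 (k + m) m
    g j = 𝒞 j 0
    length≡ : ∀ m K → m * 2 + suc (K * 2) ≡ m + K + suc (m + K)
    length≡ = ℕ-Solver.solve-∀
    index≡ : ∀ m K → suc K + m * 2 ≡ suc (m + K) + m
    index≡ = ℕ-Solver.solve-∀
    steps≡length : ∀ m K → suc K + (m * 2 + K) ≡ m * 2 + suc (K * 2)
    steps≡length = ℕ-Solver.solve-∀
    height-balance : ∀ m K → suc (0 + (m * 2 + K)) ≡ suc K + m * 2
    height-balance = ℕ-Solver.solve-∀

module Binomial where

  open import Data.Nat
  open import Data.Nat.Properties
  open import Data.Nat.Combinatorics using (_C_; nCk+nC[k+1]≡[n+1]C[k+1]; k>n⇒nCk≡0; nC1≡n)
  open import Data.Nat.Tactic.RingSolver using (solve-∀)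
  open import Data.Product using (_,_)
  open import Relation.Binary.PropositionalEquality
  open SumsAndProducts using (prodℕ; prodℕ-suc)

  [1+k]*[1+n]C[1+k]≡[1+n]*nCk : ∀ n k → suc k * (suc n C suc k) ≡ suc n * (n C k)
  [1+k]*[1+n]C[1+k]≡[1+n]*nCk zero    zero    = refl
  [1+k]*[1+n]C[1+k]≡[1+n]*nCk zero    (suc k) =
    trans (cong (suc (suc k) *_) (k>n⇒nCk≡0 {1} {suc (suc k)} (s<s z<s)))
          (trans (*-zeroʳ (suc (suc k))) (sym (cong (1 *_) (k>n⇒nCk≡0 {0} {suc k} z<s))))
  [1+k]*[1+n]C[1+k]≡[1+n]*nCk (suc n) zero    =
    trans (*-identityˡ _) (trans (nC1≡n (suc (suc n))) (sym (*-identityʳ (suc (suc n)))))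
  [1+k]*[1+n]C[1+k]≡[1+n]*nCk (suc n) (suc k) = begin
    suc (suc k) * (suc (suc n) C suc (suc k))
      ≡⟨ cong (suc (suc k) *_) (sym (nCk+nC[k+1]≡[n+1]C[k+1] (suc n) (suc k))) ⟩
    suc (suc k) * (X + Y)
      ≡⟨ split k X Y ⟩
    X + (suc k * X + suc (suc k) * Y)
      ≡⟨ cong₂ (λ u v → X + (u + v)) ([1+k]*[1+n]C[1+k]≡[1+n]*nCk n k)
                                   ([1+k]*[1+n]C[1+k]≡[1+n]*nCk n (suc k)) ⟩
    X + (suc n * (n C k) + suc n * (n C suc k))
      ≡⟨ cong (X +_) (sym (*-distribˡ-+ (suc n) (n C k) (n C suc k))) ⟩
    X + suc n * (n C k + n C suc k)
      ≡⟨ cong (λ Z → X + suc n * Z) (nCk+nC[k+1]≡[n+1]C[k+1] n k) ⟩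
    X + suc n * X ∎
    where
    open ≡-Reasoning
    X Y : ℕ
    X = suc n C suc k
    Y = suc n C suc (suc k)
    split : ∀ k X Y → suc (suc k) * (X + Y) ≡ X + (suc k * X + suc (suc k) * Y)
    split = solve-∀

  binomial-ratio : ∀ L r d → r + d ≡ L → suc r * (L C suc r) ≡ d * (L C r)
  binomial-ratio L r d r+d≡L = +-cancelˡ-≡ (suc r * (L C r)) _ _ (begin
    suc r * (L C r) + suc r * (L C suc r)
      ≡⟨ sym (*-distribˡ-+ (suc r) (L C r) (L C suc r)) ⟩
    suc r * (L C r + L C suc r)
      ≡⟨ cong (suc r *_) (nCk+nC[k+1]≡[n+1]C[k+1] L r) ⟩
    suc r * (suc L C suc r)
      ≡⟨ [1+k]*[1+n]C[1+k]≡[1+n]*nCk L r ⟩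
    suc L * (L C r)
      ≡⟨ cong (λ n → suc n * (L C r)) (sym r+d≡L) ⟩
    (suc r + d) * (L C r)
      ≡⟨ *-distribʳ-+ (L C r) (suc r) d ⟩
    suc r * (L C r) + d * (L C r) ∎)
    where open ≡-Reasoning

  [2n]Cn≡2*[2n∸1]Cn : ∀ p → (2 * suc p) C suc p ≡ 2 * ((p + suc p) C suc p)
  [2n]Cn≡2*[2n∸1]Cn p = begin
    (2 * suc p) C suc p
      ≡⟨ cong (_C suc p) (double p) ⟩
    suc L C suc p
      ≡⟨ sym (nCk+nC[k+1]≡[n+1]C[k+1] L p) ⟩
    L C p + L C suc p
      ≡⟨ cong (_+ L C suc p) (sym (*-cancelˡ-≡ _ _ (suc p) (binomial-ratio L p (suc p) refl))) ⟩
    L C suc p + L C suc p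
      ≡⟨ cong (L C suc p +_) (sym (+-identityʳ (L C suc p))) ⟩
    2 * (L C suc p) ∎
    where
    open ≡-Reasoning
    L : ℕ
    L = p + suc p
    double : ∀ p → 2 * suc p ≡ suc (p + suc p)
    double = solve-∀

  [2n]Cn*falling≡2*rising*[2n∸1]C[n+j] : ∀ p j → j ≤ p →
    ((2 * suc p) C suc p) * prodℕ (suc j) (suc p ∸_)
      ≡ 2 * prodℕ (suc j) (suc p +_) * ((p + suc p) C (suc p + j))
  [2n]Cn*falling≡2*rising*[2n∸1]C[n+j] p zero    _ = begin
    ((2 * n) C n) * (n * 1)
      ≡⟨ cong (_* (n * 1)) ([2n]Cn≡2*[2n∸1]Cn p) ⟩
    2 * (L C n) * (n * 1)
      ≡⟨ rearrange (L C n) n ⟩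
    2 * ((n + 0) * 1) * (L C n)
      ≡⟨ cong (λ k → 2 * ((n + 0) * 1) * (L C k)) (sym (+-identityʳ n)) ⟩
    2 * ((n + 0) * 1) * (L C (n + 0)) ∎
    where
    open ≡-Reasoning
    n L : ℕ
    n = suc p
    L = p + suc p
    rearrange : ∀ c n → 2 * c * (n * 1) ≡ 2 * ((n + 0) * 1) * c
    rearrange = solve-∀
  [2n]Cn*falling≡2*rising*[2n∸1]C[n+j] p (suc j) j<p = begin
    ((2 * n) C n) * prodℕ (2 + j) (n ∸_)
      ≡⟨ cong (((2 * n) C n) *_) (prodℕ-suc (suc j) (n ∸_)) ⟩
    ((2 * n) C n) * (prodℕ (suc j) (n ∸_) * (p ∸ j))
      ≡⟨ sym (*-assoc ((2 * n) C n) _ _) ⟩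
    ((2 * n) C n) * prodℕ (suc j) (n ∸_) * (p ∸ j)
      ≡⟨ cong (_* (p ∸ j)) ([2n]Cn*falling≡2*rising*[2n∸1]C[n+j] p j (<⇒≤ j<p)) ⟩
    2 * P * (L C (n + j)) * (p ∸ j)
      ≡⟨ rearrange₁ P (L C (n + j)) (p ∸ j) ⟩
    2 * P * ((p ∸ j) * (L C (n + j)))
      ≡⟨ cong (2 * P *_) (sym (binomial-ratio L (n + j) (p ∸ j) gap)) ⟩
    2 * P * (suc (n + j) * (L C suc (n + j)))
      ≡⟨ rearrange₂ P (suc (n + j)) (L C suc (n + j)) ⟩
    2 * (P * suc (n + j)) * (L C suc (n + j))
      ≡⟨ cong (λ k → 2 * (P * k) * (L C k)) (sym (+-suc n j)) ⟩
    2 * (P * (n + suc j)) * (L C (n + suc j))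
      ≡⟨ cong (λ Q → 2 * Q * (L C (n + suc j))) (sym (prodℕ-suc (suc j) (n +_))) ⟩
    2 * prodℕ (2 + j) (n +_) * (L C (n + suc j)) ∎
    where
    open ≡-Reasoning
    n L P : ℕ
    n = suc p
    L = p + suc p
    P = prodℕ (suc j) (n +_)
    gap : n + j + (p ∸ j) ≡ L
    gap = trans (+-assoc n j (p ∸ j)) (trans (cong (n +_) (m+[n∸m]≡n (<⇒≤ j<p))) (+-comm n p))
    rearrange₁ : ∀ P c d → 2 * P * c * d ≡ 2 * P * (d * c)
    rearrange₁ = solve-∀
    rearrange₂ : ∀ P a c → 2 * P * (a * c) ≡ 2 * (P * a) * c
    rearrange₂ = solve-∀

  ballot-difference⇒central-binomial : ∀ {p m S} → m ≤ p →
    S + (p + suc p) C suc (suc p + m) ≡ (p + suc p) C (suc p + m) →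
    (m + 1) * (((2 * suc p) C suc p) * prodℕ (suc m) (suc p ∸_))
      ≡ (suc p + m + 1) * (prodℕ (suc m) (suc p +_) * S)
  ballot-difference⇒central-binomial {m = m} {S} m≤p S+C≡C
    with d , refl ← m≤n⇒∃[o]m+o≡n m≤p = begin
    (m + 1) * (((2 * n) C n) * prodℕ (suc m) (n ∸_))
      ≡⟨ cong ((m + 1) *_) ([2n]Cn*falling≡2*rising*[2n∸1]C[n+j] (m + d) m m≤p) ⟩
    (m + 1) * (2 * P * c)
      ≡⟨ rearrange₁ m P c ⟩
    P * (2 * (m + 1) * c)
      ≡⟨ cong (P *_) (sym [r+1]*S≡2*[m+1]*c) ⟩
    P * ((r + 1) * S)
      ≡⟨ rearrange₂ P (r + 1) S ⟩
    (r + 1) * (P * S) ∎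
    where
    open ≡-Reasoning
    n L r c P : ℕ
    n = suc (m + d)
    L = m + d + n
    r = n + m
    c = L C r
    P = prodℕ (suc m) (n +_)
    rearrange₁ : ∀ m P c → (m + 1) * (2 * P * c) ≡ P * (2 * (m + 1) * c)
    rearrange₁ = solve-∀
    rearrange₂ : ∀ P a S → P * (a * S) ≡ a * (P * S)
    rearrange₂ = solve-∀
    gap : ∀ m d → suc (m + d) + m + d ≡ m + d + suc (m + d)
    gap = solve-∀
    rearrange₃ : ∀ r x S → suc r * x + (r + 1) * S ≡ (r + 1) * (S + x)
    rearrange₃ = solve-∀
    split : ∀ m d c → (suc (m + d) + m + 1) * c ≡ d * c + 2 * (m + 1) * c
    split = solve-∀
    [r+1]*S≡2*[m+1]*c : (r + 1) * S ≡ 2 * (m + 1) * c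
    [r+1]*S≡2*[m+1]*c = +-cancelˡ-≡ (d * c) _ _ (begin
      d * c + (r + 1) * S
        ≡⟨ cong (_+ (r + 1) * S) (sym (binomial-ratio L r d (gap m d))) ⟩
      suc r * (L C suc r) + (r + 1) * S
        ≡⟨ rearrange₃ r (L C suc r) S ⟩
      (r + 1) * (S + L C suc r)
        ≡⟨ cong ((r + 1) *_) S+C≡C ⟩
      (r + 1) * c
        ≡⟨ split m d c ⟩
      d * c + 2 * (m + 1) * c ∎)

module Fractions where

  open import Data.Nat as ℕ using (ℕ; zero; suc; NonZero)
  import Data.Nat.Properties as ℕ
  import Data.Nat.Tactic.RingSolver as ℕ-Solver
  open import Data.Nat.ListAction using (product)
  open import Data.Integer using (+_)
  open import Data.Integer.Properties using (pos-*)
  open import Data.List using ([]; _∷_; map; foldr; upTo)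
  open import Data.Rational using (_*_; 1ℚ; toℚᵘ)
  open import Data.Rational.Properties
    using (toℚᵘ-injective; toℚᵘ-homo-*; toℚᵘ-fromℚᵘ; fromℚᵘ-cong; *-zeroˡ; *-zeroʳ)
  open import Data.Rational.Unnormalised as ℚᵘ using (mkℚᵘ; *≡*)
  import Data.Rational.Unnormalised.Properties as ℚᵘ
  open import Relation.Binary.PropositionalEquality
  open SumsAndProducts using (prodℕ)

  -- No side conditions are needed: the junk value frac a 0 = 0 is absorbing.
  frac-* : ∀ a b c d → frac a b * frac c d ≡ frac (a ℕ.* c) (b ℕ.* d)
  frac-* a zero    c d       = *-zeroˡ (frac c d)
  frac-* a (suc b) c zero    =
    trans (*-zeroʳ (frac a (suc b))) (cong (frac (a ℕ.* c)) (sym (ℕ.*-zeroʳ (suc b))))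
  frac-* a (suc b) c (suc d) = toℚᵘ-injective (begin
    toℚᵘ (frac a (suc b) * frac c (suc d))
      ≈⟨ toℚᵘ-homo-* (frac a (suc b)) (frac c (suc d)) ⟩
    toℚᵘ (frac a (suc b)) ℚᵘ.* toℚᵘ (frac c (suc d))
      ≈⟨ ℚᵘ.*-cong (toℚᵘ-fromℚᵘ (mkℚᵘ (+ a) b)) (toℚᵘ-fromℚᵘ (mkℚᵘ (+ c) d)) ⟩
    mkℚᵘ (+ a) b ℚᵘ.* mkℚᵘ (+ c) d
      ≡⟨ cong (λ z → mkℚᵘ z (d ℕ.+ b ℕ.* suc d)) (sym (pos-* a c)) ⟩
    mkℚᵘ (+ (a ℕ.* c)) (d ℕ.+ b ℕ.* suc d)
      ≈⟨ ℚᵘ.≃-sym (toℚᵘ-fromℚᵘ (mkℚᵘ (+ (a ℕ.* c)) (d ℕ.+ b ℕ.* suc d))) ⟩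
    toℚᵘ (frac (a ℕ.* c) (suc b ℕ.* suc d)) ∎)
    where open ℚᵘ.≃-Reasoning

  frac-cross : ∀ a b c d .{{_ : NonZero b}} .{{_ : NonZero d}} →
               a ℕ.* d ≡ c ℕ.* b → frac a b ≡ frac c d
  frac-cross a (suc b) c (suc d) ad≡cb =
    fromℚᵘ-cong {mkℚᵘ (+ a) b} {mkℚᵘ (+ c) d}
      (*≡* (trans (sym (pos-* a (suc d))) (trans (cong +_ ad≡cb) (pos-* c (suc b)))))

  prodℚ-frac : ∀ M f g → prodℚ M (λ k → frac (f k) (g k)) ≡ frac (prodℕ M f) (prodℕ M g)
  prodℚ-frac M f g = go (upTo M)
    where
    go : ∀ ks → foldr _*_ 1ℚ (map (λ k → frac (f k) (g k)) ks)
                  ≡ frac (product (map f ks)) (product (map g ks))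
    go []       = refl
    go (k ∷ ks) = trans (cong (frac (f k) (g k) *_) (go ks)) (frac-* (f k) (g k) _ _)

  ℕtoℚ≡frac*prodℚ*ℕtoℚ : ∀ {a b c s} M f g .{{_ : NonZero b}} .{{_ : NonZero (prodℕ M g)}} →
    b ℕ.* (c ℕ.* prodℕ M g) ≡ a ℕ.* (prodℕ M f ℕ.* s) →
    ℕtoℚ c ≡ frac a b * (prodℚ M (λ k → frac (f k) (g k)) * ℕtoℚ s)
  ℕtoℚ≡frac*prodℚ*ℕtoℚ {a} {b} {c} {s} M f g cross = begin
    frac c 1
      ≡⟨ frac-cross c 1 (a ℕ.* (P ℕ.* s)) (b ℕ.* (Q ℕ.* 1))
           (trans (rearrange b c Q) (trans cross (sym (ℕ.*-identityʳ (a ℕ.* (P ℕ.* s)))))) ⟩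
    frac (a ℕ.* (P ℕ.* s)) (b ℕ.* (Q ℕ.* 1))
      ≡⟨ sym (trans (cong (frac a b *_) (frac-* P Q s 1)) (frac-* a b (P ℕ.* s) (Q ℕ.* 1))) ⟩
    frac a b * (frac P Q * frac s 1)
      ≡⟨ cong (λ x → frac a b * (x * ℕtoℚ s)) (sym (prodℚ-frac M f g)) ⟩
    frac a b * (prodℚ M (λ k → frac (f k) (g k)) * ℕtoℚ s) ∎
    where
    open ≡-Reasoning
    P Q : ℕ
    P = prodℕ M f
    Q = prodℕ M g
    instance
      Q*1≢0 : NonZero (Q ℕ.* 1)
      Q*1≢0 = ℕ.m*n≢0 Q 1
      b*Q*1≢0 : NonZero (b ℕ.* (Q ℕ.* 1))
      b*Q*1≢0 = ℕ.m*n≢0 b (Q ℕ.* 1)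
    rearrange : ∀ b c Q → c ℕ.* (b ℕ.* (Q ℕ.* 1)) ≡ b ℕ.* (c ℕ.* Q)
    rearrange = ℕ-Solver.solve-∀

open import Data.Nat using (ℕ; zero; suc; _+_; _∸_; _<_; s≤s; s≤s⁻¹; NonZero; ≢-nonZero; >-nonZero)
open import Data.Nat.Properties using (≤-trans; m+1+n≢0; m<n⇒0<n∸m)
open import Data.Nat.Combinatorics using (_C_)
open import Data.Rational using (_*_)
open import Relation.Binary.PropositionalEquality using (_≡_)
open SumsAndProducts using (prodℕ; prodℕ-nonZero)
open LatticePaths using (𝒞-convolution-ballot)
open Binomial using (ballot-difference⇒central-binomial)
open Fractions using (ℕtoℚ≡frac*prodℚ*ℕtoℚ)

corollary5p2 : (n m : ℕ) → m < n →
    ℕtoℚ ((2 Data.Nat.* n) C n)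
      ≡ frac (n + m + 1) (m + 1)
          * (prodℚ (suc m) (λ k → frac (n + k) (n ∸ k))
          * ℕtoℚ (sumℕ (n ∸ m) (λ k → 𝒞 (k + m) m Data.Nat.* 𝒞 (n ∸ m ∸ k ∸ 1) 0)))
corollary5p2 zero    m ()
corollary5p2 (suc p) m (s≤s m≤p) =
  ℕtoℚ≡frac*prodℚ*ℕtoℚ {c = (2 Data.Nat.* suc p) C suc p} (suc m) (suc p +_) (suc p ∸_)
    (ballot-difference⇒central-binomial m≤p (𝒞-convolution-ballot m≤p))
  where
  instance
    m+1≢0 : NonZero (m + 1)
    m+1≢0 = ≢-nonZero (m+1+n≢0 m)
    falling≢0 : NonZero (prodℕ (suc m) (suc p ∸_))
    falling≢0 = prodℕ-nonZero (suc m) (suc p ∸_) λ k k<1+m →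
      >-nonZero (m<n⇒0<n∸m (s≤s (≤-trans (s≤s⁻¹ k<1+m) m≤p)))
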